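{- Let $A$ be a finite alphabet and let $f\colon A^*\to A^*$ be a non-erasing Parikh-collinear morphism prolongable on a letter $a\in A$, such that every letter of $A$ occurs in $f^n(a)$ for some $n\ge0$. Then $f$ is primitive.
   Context: For $w\in A^*$, $\Psi(w)$ is the Parikh vector of $w$ (the vector of the numbers of occurrences of each letter in $w$, for a fixed order on $A$). A morphism $f\colon A^*\to A^*$ is Parikh-collinear if the vectors $\Psi(f(b))$, $b\in A$, are pairwise $\mathbb{Z}$-linearly dependent, and non-erasing if $f(b)\neq\varepsilon$ for all $b\in A$. $f$ is prolongable on $a$ if $f(a)=au$ for some word $u$ and $|f^n(a)|\to\infty$. The adjacency matrix $M_f\in\mathbb{N}^{A\times A}$ has entries $[M_f]_{b,c}=|f(c)|_b$. A morphism $f$ is primitive if $M_f^n$ has only positive entries for some $n\in\mathbb{N}$. -}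

module Defs where

open import Data.Nat using (ℕ; zero; suc; _+_; _*_; _≤_; _<_)
open import Data.Integer as ℤ using (ℤ; +_)
open import Data.Fin using (Fin; zero; suc; _≟_)
open import Data.List using (List; []; _∷_; _++_; concatMap; length)
open import Data.List.Membership.Propositional using (_∈_)
open import Data.Product using (Σ; ∃; ∃-syntax; _×_; _,_)
open import Relation.Nullary using (¬_; yes; no)
open import Relation.Binary.PropositionalEquality using (_≡_; _≢_)

Word : ℕ → Set
Word k = List (Fin k)

Morphism : ℕ → Set
Morphism k = Fin k → Word k

apply : ∀ {k} → Morphism k → Word k → Word k
apply f w = concatMap f w

iter : ∀ {k} → Morphism k → ℕ → Word k → Word k
iter f zero    w = w
iter f (suc n) w = apply f (iter f n w)

occ : ∀ {k} → Fin k → Word k → ℕ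
occ b [] = 0
occ b (c ∷ w) with b ≟ c
... | yes _ = suc (occ b w)
... | no  _ = occ b w

Ψ : ∀ {k} → Word k → Fin k → ℕ
Ψ w b = occ b w

LinDepℤ : ∀ {k} → (Fin k → ℕ) → (Fin k → ℕ) → Set
LinDepℤ u v = ∃[ p ] ∃[ q ] (¬ (p ≡ + 0 × q ≡ + 0) ×
  (∀ x → p ℤ.* (+ u x) ℤ.+ q ℤ.* (+ v x) ≡ + 0))

ParikhCollinear : ∀ {k} → Morphism k → Set
ParikhCollinear f = ∀ b c → LinDepℤ (Ψ (f b)) (Ψ (f c))

NonErasing : ∀ {k} → Morphism k → Set
NonErasing f = ∀ b → f b ≢ []

Prolongable : ∀ {k} → Morphism k → Fin k → Set
Prolongable f a = (∃[ u ] f a ≡ a ∷ u) ×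
  (∀ N → ∃[ n₀ ] ∀ n → n₀ ≤ n → N ≤ length (iter f n (a ∷ [])))

∑ : ∀ {k} → (Fin k → ℕ) → ℕ
∑ {zero}  g = 0
∑ {suc k} g = g zero + ∑ {k} (λ i → g (suc i))

Matrix : ℕ → Set
Matrix k = Fin k → Fin k → ℕ

adj : ∀ {k} → Morphism k → Matrix k
adj f b c = occ b (f c)

identity : ∀ {k} → Matrix k
identity b c with b ≟ c
... | yes _ = 1
... | no  _ = 0

_⊗_ : ∀ {k} → Matrix k → Matrix k → Matrix k
(M ⊗ N) b c = ∑ (λ d → M b d * N d c)

_^ᴹ_ : ∀ {k} → Matrix k → ℕ → Matrix k
M ^ᴹ zero  = identity
M ^ᴹ suc n = M ⊗ (M ^ᴹ n)

Primitive : ∀ {k} → Morphism k → Set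
Primitive f = ∃[ n ] ∀ b c → 0 < (adj f ^ᴹ n) b c

{-# OPTIONS --safe #-}
module Submission where

-- Two ℤ-linearly dependent vectors of ℕ^A, the second one nonzero, have the
-- first one's support contained in the second one's.  Since f is non-erasing,
-- Parikh-collinearity therefore makes all images f(c) share one support S.
-- Every letter of f^(n+1)(a) lies in some f(c), hence in S, and a ∈ f(a) ⊆ S;
-- so S = A by hypothesis, i.e. every entry of M_f itself is positive.

open import Defs
open import Data.Nat using (ℕ; zero; suc; _≤_; _<_; z≤n; s≤s; _*_)
import Data.Nat.Properties as ℕ
open import Data.Integer as ℤ using (+_)
import Data.Integer.Properties as ℤ
open import Data.Fin using (Fin; zero; suc; _≟_)
open import Data.List using (_∷_; [])
open import Data.List.Relation.Unary.Any using (here; there; satisfied)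
open import Data.List.Membership.Propositional using (_∈_)
open import Data.List.Membership.Propositional.Properties using (∈-concatMap⁻)
open import Data.Product using (∃-syntax; _,_)
open import Data.Sum using (inj₁; inj₂)
open import Relation.Nullary using (yes; no; contradiction)
open import Relation.Binary.PropositionalEquality
open ≡-Reasoning

∈⇒occ>0 : ∀ {k} {b : Fin k} {w} → b ∈ w → 0 < occ b w
∈⇒occ>0 {b = b} {c ∷ w} b∈c∷w with b ≟ c | b∈c∷w
... | yes _  | _          = s≤s z≤n
... | no b≢c | here b≡c   = contradiction b≡c b≢c
... | no _   | there b∈w  = ∈⇒occ>0 b∈w

*-cancelʳ-≡0 : ∀ p {n} → 0 < n → p ℤ.* + n ≡ + 0 → p ≡ + 0
*-cancelʳ-≡0 p 0<n pn≡0 with ℤ.i*j≡0⇒i≡0∨j≡0 p pn≡0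
... | inj₁ p≡0 = p≡0
... | inj₂ n≡0 = contradiction (ℤ.+-injective n≡0) (ℕ.>⇒≢ 0<n)

LinDepℤ⇒support⊆ : ∀ {k} {u v : Fin k → ℕ} → LinDepℤ u v →
                   ∀ {y} → 0 < v y → ∀ {x} → 0 < u x → 0 < v x
LinDepℤ⇒support⊆ {u = u} {v} (p , q , ¬p≡0×q≡0 , comb) {y} 0<vy {x} 0<ux =
  ℕ.n≢0⇒n>0 vx≢0
  where
  vx≢0 : v x ≢ 0
  vx≢0 vx≡0 = ¬p≡0×q≡0 (p≡0 , q≡0)
    where
    p≡0 : p ≡ + 0
    p≡0 = *-cancelʳ-≡0 p 0<ux (begin
      p ℤ.* + u x                    ≡⟨ ℤ.+-identityʳ _ ⟨
      p ℤ.* + u x ℤ.+ + 0            ≡⟨ cong (λ t → p ℤ.* + u x ℤ.+ t) (ℤ.*-zeroʳ q) ⟨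
      p ℤ.* + u x ℤ.+ q ℤ.* + 0      ≡⟨ cong (λ t → p ℤ.* + u x ℤ.+ q ℤ.* + t) vx≡0 ⟨
      p ℤ.* + u x ℤ.+ q ℤ.* + v x    ≡⟨ comb x ⟩
      + 0                            ∎)
    q≡0 : q ≡ + 0
    q≡0 = *-cancelʳ-≡0 q 0<vy (begin
      q ℤ.* + v y                    ≡⟨ ℤ.+-identityˡ _ ⟨
      + 0 ℤ.+ q ℤ.* + v y            ≡⟨ cong (λ t → t ℤ.+ q ℤ.* + v y) (ℤ.*-zeroˡ (+ u y)) ⟨
      + 0 ℤ.* + u y ℤ.+ q ℤ.* + v y  ≡⟨ cong (λ t → t ℤ.* + u y ℤ.+ q ℤ.* + v y) p≡0 ⟨
      p ℤ.* + u y ℤ.+ q ℤ.* + v y    ≡⟨ comb y ⟩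
      + 0                            ∎)

module _ {k} {f : Morphism k} (nonErasing : NonErasing f) (collinear : ParikhCollinear f) where

  NonErasing⇒image-occ>0 : ∀ c → ∃[ y ] 0 < occ y (f c)
  NonErasing⇒image-occ>0 c with f c in fc≡
  ... | []    = contradiction fc≡ (nonErasing c)
  ... | y ∷ w = y , ∈⇒occ>0 {w = y ∷ w} (here refl)

  image-support-invariant : ∀ {b c d} → 0 < occ d (f b) → 0 < occ d (f c)
  image-support-invariant {b} {c} 0<dfb with NonErasing⇒image-occ>0 c
  ... | y , 0<yfc = LinDepℤ⇒support⊆ (collinear b c) 0<yfc 0<dfb

  ∈-apply⇒occ>0 : ∀ {b c w} → b ∈ apply f w → 0 < occ b (f c)
  ∈-apply⇒occ>0 {w = w} b∈fw with satisfied (∈-concatMap⁻ f {xs = w} b∈fw)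
  ... | _ , b∈fd = image-support-invariant (∈⇒occ>0 b∈fd)

∑-term≤ : ∀ {k} (g : Fin k → ℕ) d → g d ≤ ∑ g
∑-term≤ g zero          = ℕ.m≤m+n _ _
∑-term≤ {suc k} g (suc d) = ℕ.≤-trans (∑-term≤ (λ i → g (suc i)) d) (ℕ.m≤n+m _ (g zero))

identity-diagonal : ∀ {k} (c : Fin k) → identity c c ≡ 1
identity-diagonal c with c ≟ c
... | yes _   = refl
... | no c≢c  = contradiction refl c≢c

entry≤^ᴹ1 : ∀ {k} (M : Matrix k) b c → M b c ≤ (M ^ᴹ 1) b c
entry≤^ᴹ1 M b c = ℕ.≤-trans M[b,c]≤ (∑-term≤ (λ d → M b d * identity d c) c)
  where
  M[b,c]≤ : M b c ≤ M b c * identity c c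
  M[b,c]≤ = ℕ.≤-reflexive (begin
    M b c                   ≡⟨ ℕ.*-identityʳ _ ⟨
    M b c * 1               ≡⟨ cong (M b c *_) (identity-diagonal c) ⟨
    M b c * identity c c    ∎)

lemma4 : (k : ℕ) (f : Morphism k) (a : Fin k) →
    NonErasing f → ParikhCollinear f → Prolongable f a →
    (∀ b → ∃[ n ] b ∈ iter f n (a ∷ [])) →
    Primitive f
lemma4 k f a nonErasing collinear ((u , fa≡au) , _) reachable =
  1 , λ b c → ℕ.<-≤-trans (adj-positive b c) (entry≤^ᴹ1 (adj f) b c)
  where
  reachable⇒occ>0 : ∀ {b} n → b ∈ iter f n (a ∷ []) → ∀ c → 0 < occ b (f c)
  reachable⇒occ>0 zero    (here refl) c =
    image-support-invariant nonErasing collinear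
      (subst (λ w → 0 < occ a w) (sym fa≡au) (∈⇒occ>0 {w = a ∷ u} (here refl)))
  reachable⇒occ>0 (suc n) b∈fⁿ⁺¹a   c = ∈-apply⇒occ>0 nonErasing collinear {w = iter f n (a ∷ [])} b∈fⁿ⁺¹a

  adj-positive : ∀ b c → 0 < adj f b c
  adj-positive b with reachable b
  ... | n , b∈fⁿa = reachable⇒occ>0 n b∈fⁿa
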